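{- Let $\mathbb{K}$ be a field, let $k\ge 1$ be an integer, let $\rho:\mathbb{N}^{+}\to\mathbb{K}$ be any function, and let $f(x)\in\mathbb{K}[[x]]$ satisfy $$1+\sum_{n\ge 1}\Big(\sum_{T\in T_k(n)}\prod_{h\in\mathcal{H}(T)}\rho(h)\Big)x^n=f(x).$$ Then for every $n\ge 1$ with $[x^{n-1}]f(x)^k\neq 0$, $$\rho(n)=\frac{[x^n]f(x)}{[x^{n-1}]f(x)^k}.$$
   Context: A $k$-ary tree is an ordered rooted unlabeled tree in which every vertex has exactly $k$ subtrees in linear order, where a subtree is allowed to be empty. $T_k(n)$ denotes the set of $k$-ary trees with $n$ vertices. For a tree $T$ and a vertex $u$, the hook length $h_u$ is the number of descendants of $u$ in $T$, counting $u$ itself; $\mathcal{H}(T)$ is the multiset $\{h_u: u\in T\}$, so $\prod_{h\in\mathcal{H}(T)}\rho(h)=\prod_{u\in T}\rho(h_u)$. $[x^n]g(x)$ denotes the coefficient of $x^n$ in the formal power series $g(x)$. -}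

module Defs where

open import Level using (Level; _⊔_; suc)
open import Data.Nat as ℕ using (ℕ; zero; _∸_; _≟_)
  renaming (suc to sucℕ; _+_ to _+ℕ_)
open import Data.Vec using (Vec; []; _∷_)
open import Data.List using (List; []; _∷_; map; concatMap; filter; upTo)
open import Algebra.Bundles using (CommutativeRing)
open import Relation.Nullary using (¬_)

record Field (c ℓ : Level) : Set (suc (c ⊔ ℓ)) where
  field
    commutativeRing : CommutativeRing c ℓ
  open CommutativeRing commutativeRing public
  field
    1≉0      : ¬ (1# ≈ 0#)
    _⁻¹      : (x : Carrier) → ¬ (x ≈ 0#) → Carrier
    ⁻¹-inverse : (x : Carrier) (x≉0 : ¬ (x ≈ 0#)) → x * (x ⁻¹) x≉0 ≈ 1#

data Tree (k : ℕ) : Set where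
  empty : Tree k
  node  : Vec (Tree k) k → Tree k

mutual
  size : ∀ {k} → Tree k → ℕ
  size empty     = 0
  size (node ts) = sucℕ (sizes ts)

  sizes : ∀ {k m} → Vec (Tree k) m → ℕ
  sizes []       = 0
  sizes (t ∷ ts) = size t +ℕ sizes ts

-- All k-ary trees of height at most h (height counted in vertex levels;
-- the empty tree has height 0). Each such tree is listed exactly once.
tuples : ∀ {A : Set} (m : ℕ) → List A → List (Vec A m)
tuples zero     xs = [] ∷ []
tuples (sucℕ m) xs = concatMap (λ x → map (x ∷_) (tuples m xs)) xs

treesOfHeight≤ : (k h : ℕ) → List (Tree k)
treesOfHeight≤ k zero     = empty ∷ []
treesOfHeight≤ k (sucℕ h) = empty ∷ map node (tuples k (treesOfHeight≤ k h))

-- T_k(n): all k-ary trees with exactly n vertices (such a tree has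
-- height ≤ n, so it appears in treesOfHeight≤ k n).
T : (k n : ℕ) → List (Tree k)
T k n = filter (λ t → size t ≟ n) (treesOfHeight≤ k n)

module _ {c ℓ} (K : Field c ℓ) where
  open Field K

  Σ-list : List Carrier → Carrier
  Σ-list []       = 0#
  Σ-list (x ∷ xs) = x + Σ-list xs

  mutual
    hookProd : ∀ {k} → (ℕ → Carrier) → Tree k → Carrier
    hookProd ρ empty     = 1#
    hookProd ρ (node ts) = ρ (size (node ts)) * hookProds ρ ts

    hookProds : ∀ {k m} → (ℕ → Carrier) → Vec (Tree k) m → Carrier
    hookProds ρ []       = 1#
    hookProds ρ (t ∷ ts) = hookProd ρ t * hookProds ρ ts

  PowerSeries : Set c
  PowerSeries = ℕ → Carrier

  _·_ : PowerSeries → PowerSeries → PowerSeries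
  (f · g) n = Σ-list (map (λ i → f i * g (n ∸ i)) (upTo (sucℕ n)))

  one : PowerSeries
  one zero     = 1#
  one (sucℕ _) = 0#

  _^_ : PowerSeries → ℕ → PowerSeries
  f ^ zero     = one
  f ^ sucℕ m   = f · (f ^ m)

  coeff : ℕ → PowerSeries → Carrier
  coeff n g = g n

-- Let F_h be the hook-weighted generating function of the k-ary trees of
-- height at most h.  A nonempty tree is a root together with k subtrees, and
-- the hook length of the root is the size of the tree, so
-- [x^(m+1)] F_(h+1) = ρ(m+1) · [x^m] F_h^k.  Since [x^i] F_h stops depending
-- on h once h ≥ i, the series f of all trees satisfies
-- [x^(m+1)] f = ρ(m+1) · [x^m] f^k, which is solved for ρ(m+1).
module Submission where

open import Defs
open import Data.Nat using (ℕ; zero; suc; _≤_; _<_; _∸_; _≟_; _<?_; z≤n; s≤s)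
  renaming (_+_ to _+ℕ_)
import Data.Nat.Properties as ℕ
open import Data.List using (List; []; _∷_; map; concatMap; filter; upTo; _++_; [_])
open import Data.List.Properties using (upTo-∷ʳ)
open import Data.List.Membership.Propositional using (_∈_)
open import Data.List.Membership.Propositional.Properties using (∈-upTo⁻)
open import Data.List.Relation.Unary.Any using (here; there)
open import Data.Product using (_×_; _,_)
open import Data.Sum using (_⊎_; inj₁; inj₂; [_,_]′)
open import Data.Vec using (Vec; _∷_)
open import Data.Empty using (⊥-elim)
open import Function using (_∘_)
open import Function.Bundles using (_⇔_; mk⇔; Equivalence)
open import Relation.Nullary using (¬_; Dec; yes; no)
open import Relation.Nullary.Decidable using (_×-dec_; _⊎-dec_)
open import Relation.Binary.PropositionalEquality as ≡ using (_≡_)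
import Relation.Binary.Reasoning.Setoid as SetoidReasoning
import Algebra.Properties.CommutativeSemigroup as CommutativeSemigroupProperties

m<1+n⇔m<n⊎m≡n : ∀ {m n} → m < suc n ⇔ (m < n ⊎ m ≡ n)
m<1+n⇔m<n⊎m≡n = mk⇔ ℕ.m<1+n⇒m<n∨m≡n [ ℕ.m<n⇒m<1+n , ℕ.≤-reflexive ∘ ≡.cong suc ]′

m<1+n×o≡n∸m⇔m+o≡n : ∀ m n o → (m < suc n × o ≡ n ∸ m) ⇔ (m +ℕ o ≡ n)
m<1+n×o≡n∸m⇔m+o≡n m n o = mk⇔ to from
  where
  to : m < suc n × o ≡ n ∸ m → m +ℕ o ≡ n
  to (s≤s m≤n , ≡.refl) = ℕ.m+[n∸m]≡n m≤n

  from : m +ℕ o ≡ n → m < suc n × o ≡ n ∸ m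
  from ≡.refl = s≤s (ℕ.m≤m+n m o) , ≡.sym (ℕ.m+n∸m≡n m o)

suc⇔ : ∀ {m n} → suc m ≡ suc n ⇔ m ≡ n
suc⇔ = mk⇔ ℕ.suc-injective (≡.cong suc)

module FieldSums {c ℓ} (K : Field c ℓ) where
  open Field K
  open SetoidReasoning setoid
  open CommutativeSemigroupProperties +-commutativeSemigroup using (interchange)

  x≈y*c⇒y≈x*c⁻¹ : ∀ {x y c} (c≉0 : ¬ c ≈ 0#) → x ≈ y * c → y ≈ x * (c ⁻¹) c≉0
  x≈y*c⇒y≈x*c⁻¹ {x} {y} {c} c≉0 x≈yc = begin
    y                     ≈⟨ *-identityʳ y ⟨
    y * 1#                ≈⟨ *-congˡ (⁻¹-inverse c c≉0) ⟨
    y * (c * (c ⁻¹) c≉0)  ≈⟨ *-assoc y c _ ⟨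
    (y * c) * (c ⁻¹) c≉0  ≈⟨ *-congʳ x≈yc ⟨
    x * (c ⁻¹) c≉0        ∎

  private variable
    A B : Set
    P Q : Set

  ∑ : List A → (A → Carrier) → Carrier
  ∑ L f = Σ-list K (map f L)

  infix 7 ∑
  syntax ∑ L (λ x → e) = ∑[ x ∈ L ] e

  ∑-cong∈ : ∀ (L : List A) {f g : A → Carrier} → (∀ {x} → x ∈ L → f x ≈ g x) → ∑ L f ≈ ∑ L g
  ∑-cong∈ []      f≈g = refl
  ∑-cong∈ (x ∷ L) f≈g = +-cong (f≈g (here ≡.refl)) (∑-cong∈ L (f≈g ∘ there))

  ∑-cong : ∀ (L : List A) {f g : A → Carrier} → (∀ x → f x ≈ g x) → ∑ L f ≈ ∑ L g
  ∑-cong L f≈g = ∑-cong∈ L (λ {x} _ → f≈g x)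

  ∑-zero : ∀ (L : List A) → ∑[ _ ∈ L ] 0# ≈ 0#
  ∑-zero []      = refl
  ∑-zero (x ∷ L) = trans (+-congˡ (∑-zero L)) (+-identityʳ 0#)

  ∑-+ : ∀ (L : List A) (f g : A → Carrier) → ∑[ x ∈ L ] (f x + g x) ≈ ∑ L f + ∑ L g
  ∑-+ []      f g = sym (+-identityʳ 0#)
  ∑-+ (x ∷ L) f g = trans (+-congˡ (∑-+ L f g)) (interchange _ _ _ _)

  ∑-distribˡ : ∀ (L : List A) a (f : A → Carrier) → a * ∑ L f ≈ ∑[ x ∈ L ] (a * f x)
  ∑-distribˡ []      a f = zeroʳ a
  ∑-distribˡ (x ∷ L) a f = trans (distribˡ a _ _) (+-congˡ (∑-distribˡ L a f))

  ∑-distribʳ : ∀ (L : List A) a (f : A → Carrier) → ∑ L f * a ≈ ∑[ x ∈ L ] (f x * a)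
  ∑-distribʳ L a f =
    trans (*-comm _ a) (trans (∑-distribˡ L a f) (∑-cong L (λ x → *-comm a (f x))))

  ∑-++ : ∀ (L M : List A) (f : A → Carrier) → ∑ (L ++ M) f ≈ ∑ L f + ∑ M f
  ∑-++ []      M f = sym (+-identityˡ _)
  ∑-++ (x ∷ L) M f = trans (+-congˡ (∑-++ L M f)) (sym (+-assoc _ _ _))

  ∑-map : (L : List A) (h : A → B) (f : B → Carrier) →
          ∑ (map h L) f ≈ ∑[ x ∈ L ] f (h x)
  ∑-map []      h f = refl
  ∑-map (x ∷ L) h f = +-congˡ (∑-map L h f)

  ∑-concatMap : (L : List A) (g : A → List B) (f : B → Carrier) →
                ∑ (concatMap g L) f ≈ ∑[ x ∈ L ] ∑ (g x) f
  ∑-concatMap []      g f = refl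
  ∑-concatMap (x ∷ L) g f = trans (∑-++ (g x) _ f) (+-congˡ (∑-concatMap L g f))

  ∑-comm : (L : List A) (M : List B) (f : A → B → Carrier) →
           ∑[ x ∈ L ] ∑[ y ∈ M ] f x y ≈ ∑[ y ∈ M ] ∑[ x ∈ L ] f x y
  ∑-comm []      M f = sym (∑-zero M)
  ∑-comm (x ∷ L) M f = trans (+-congˡ (∑-comm L M f)) (sym (∑-+ M (f x) _))

  infixr 8 [_]·_
  [_]·_ : Dec P → Carrier → Carrier
  [ yes _ ]· a = a
  [ no  _ ]· a = 0#

  []·-cong : ∀ (p : Dec P) {a b} → a ≈ b → [ p ]· a ≈ [ p ]· b
  []·-cong (yes _) a≈b = a≈b
  []·-cong (no  _) a≈b = refl

  []·-*ˡ : ∀ (p : Dec P) a b → a * [ p ]· b ≈ [ p ]· (a * b)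
  []·-*ˡ (yes _) a b = refl
  []·-*ˡ (no  _) a b = zeroʳ a

  []·-*ʳ : ∀ (p : Dec P) a b → [ p ]· a * b ≈ [ p ]· (a * b)
  []·-*ʳ (yes _) a b = refl
  []·-*ʳ (no  _) a b = zeroˡ b

  []·-nested : ∀ (p : Dec P) (q : Dec Q) a → [ p ]· [ q ]· a ≈ [ p ×-dec q ]· a
  []·-nested (yes _) (yes _) a = refl
  []·-nested (yes _) (no  _) a = refl
  []·-nested (no  _) q       a = refl

  []·-⇔ : P ⇔ Q → ∀ (p : Dec P) (q : Dec Q) a → [ p ]· a ≈ [ q ]· a
  []·-⇔ P⇔Q (yes _)  (yes _)  a = refl
  []·-⇔ P⇔Q (yes pr) (no ¬q)  a = ⊥-elim (¬q (Equivalence.to P⇔Q pr))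
  []·-⇔ P⇔Q (no ¬p)  (yes qr) a = ⊥-elim (¬p (Equivalence.from P⇔Q qr))
  []·-⇔ P⇔Q (no  _)  (no  _)  a = refl

  []·-+-disjoint : ¬ (P × Q) → ∀ (p : Dec P) (q : Dec Q) a →
                   [ p ]· a + [ q ]· a ≈ [ p ⊎-dec q ]· a
  []·-+-disjoint ¬P×Q (yes pr) (yes qr) a = ⊥-elim (¬P×Q (pr , qr))
  []·-+-disjoint ¬P×Q (yes _)  (no  _)  a = +-identityʳ a
  []·-+-disjoint ¬P×Q (no  _)  (yes _)  a = +-identityˡ a
  []·-+-disjoint ¬P×Q (no  _)  (no  _)  a = +-identityʳ 0#

  []·-subst : ∀ {a i : A} (F : A → Carrier) (d : Dec (a ≡ i)) →
              [ d ]· F i ≈ [ d ]· F a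
  []·-subst F (yes ≡.refl) = refl
  []·-subst F (no  _)      = refl

  ∑-filter : ∀ {P : A → Set} (L : List A) (P? : ∀ x → Dec (P x)) (f : A → Carrier) →
             ∑ (filter P? L) f ≈ ∑[ x ∈ L ] [ P? x ]· f x
  ∑-filter []      P? f = refl
  ∑-filter (x ∷ L) P? f with P? x
  ... | yes _ = +-congˡ (∑-filter L P? f)
  ... | no  _ = trans (∑-filter L P? f) (sym (+-identityˡ _))

  ∑-upTo-δ : ∀ a n X → ∑[ i ∈ upTo n ] [ a ≟ i ]· X ≈ [ a <? n ]· X
  ∑-upTo-δ a zero    X = refl
  ∑-upTo-δ a (suc n) X = begin
    ∑[ i ∈ upTo (suc n) ] [ a ≟ i ]· X
      ≡⟨ ≡.cong (λ L → ∑[ i ∈ L ] [ a ≟ i ]· X) (upTo-∷ʳ n) ⟨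
    ∑[ i ∈ upTo n ++ [ n ] ] [ a ≟ i ]· X
      ≈⟨ ∑-++ (upTo n) [ n ] _ ⟩
    ∑[ i ∈ upTo n ] [ a ≟ i ]· X + ([ a ≟ n ]· X + 0#)
      ≈⟨ +-cong (∑-upTo-δ a n X) (+-identityʳ _) ⟩
    [ a <? n ]· X + [ a ≟ n ]· X
      ≈⟨ []·-+-disjoint (λ (a<n , a≡n) → ℕ.<-irrefl a≡n a<n) (a <? n) (a ≟ n) X ⟩
    [ a<n⊎a≡n? ]· X
      ≈⟨ []·-⇔ m<1+n⇔m<n⊎m≡n (a <? suc n) a<n⊎a≡n? X ⟨
    [ a <? suc n ]· X
      ∎
    where
    a<n⊎a≡n? : Dec (a < n ⊎ a ≡ n)
    a<n⊎a≡n? = (a <? n) ⊎-dec (a ≟ n)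

  ∑-upTo-δ-convolution : ∀ a b m X Y →
    ∑[ i ∈ upTo (suc m) ] ([ a ≟ i ]· X * [ b ≟ m ∸ i ]· Y) ≈ [ a +ℕ b ≟ m ]· (X * Y)
  ∑-upTo-δ-convolution a b m X Y = begin
    ∑[ i ∈ U ] ([ a ≟ i ]· X * [ b ≟ m ∸ i ]· Y)
      ≈⟨ ∑-cong U (λ i → []·-*ʳ (a ≟ i) X _) ⟩
    ∑[ i ∈ U ] [ a ≟ i ]· F i
      ≈⟨ ∑-cong U (λ i → []·-subst F (a ≟ i)) ⟩
    ∑[ i ∈ U ] [ a ≟ i ]· F a
      ≈⟨ ∑-upTo-δ a (suc m) (F a) ⟩
    [ a <? suc m ]· (X * [ b ≟ m ∸ a ]· Y)
      ≈⟨ []·-cong (a <? suc m) ([]·-*ˡ (b ≟ m ∸ a) X Y) ⟩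
    [ a <? suc m ]· [ b ≟ m ∸ a ]· (X * Y)
      ≈⟨ []·-nested (a <? suc m) (b ≟ m ∸ a) _ ⟩
    [ a≤m×b≡m∸a? ]· (X * Y)
      ≈⟨ []·-⇔ (m<1+n×o≡n∸m⇔m+o≡n a m b) a≤m×b≡m∸a? (a +ℕ b ≟ m) _ ⟩
    [ a +ℕ b ≟ m ]· (X * Y)
      ∎
    where
    U : List ℕ
    U = upTo (suc m)

    F : ℕ → Carrier
    F i = X * [ b ≟ m ∸ i ]· Y

    a≤m×b≡m∸a? : Dec (a < suc m × b ≡ m ∸ a)
    a≤m×b≡m∸a? = (a <? suc m) ×-dec (b ≟ m ∸ a)

  ^-cong≤ : ∀ j m {g h : PowerSeries K} → (∀ {i} → i ≤ m → g i ≈ h i) →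
            _^_ K g j m ≈ _^_ K h j m
  ^-cong≤ zero    m g≈h = refl
  ^-cong≤ (suc j) m g≈h = ∑-cong∈ (upTo (suc m)) λ {i} i∈ →
    *-cong (g≈h (ℕ.≤-pred (∈-upTo⁻ i∈)))
           (^-cong≤ j (m ∸ i) (λ l≤m∸i → g≈h (ℕ.≤-trans l≤m∸i (ℕ.m∸n≤m m i))))

module HookSeries {c ℓ} (K : Field c ℓ) (k : ℕ) (ρ : ℕ → Field.Carrier K) where
  open Field K
  open FieldSums K
  open SetoidReasoning setoid

  hookSeries : List (Tree k) → PowerSeries K
  hookSeries L m = ∑[ t ∈ L ] [ size t ≟ m ]· hookProd K ρ t

  ∑-tuples : ∀ j (L : List (Tree k)) m →
    ∑[ ts ∈ tuples j L ] [ sizes ts ≟ m ]· hookProds K ρ ts ≈ _^_ K (hookSeries L) j m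
  ∑-tuples zero    L zero    = +-identityʳ 1#
  ∑-tuples zero    L (suc m) = +-identityʳ 0#
  ∑-tuples (suc j) L m = begin
    ∑ (tuples (suc j) L) F
      ≈⟨ ∑-concatMap L (λ t → map (t ∷_) (tuples j L)) F ⟩
    ∑[ t ∈ L ] ∑ (map (t ∷_) Ts) F
      ≈⟨ ∑-cong L (λ t → ∑-map Ts (t ∷_) F) ⟩
    ∑[ t ∈ L ] ∑[ ts ∈ Ts ] [ size t +ℕ sizes ts ≟ m ]· (hp t * hps ts)
      ≈⟨ ∑-cong L (λ t → ∑-cong Ts λ ts →
           ∑-upTo-δ-convolution (size t) (sizes ts) m (hp t) (hps ts)) ⟨
    ∑[ t ∈ L ] ∑[ ts ∈ Ts ] ∑[ i ∈ U ] G t ts i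
      ≈⟨ ∑-cong L (λ t → ∑-comm Ts U (G t)) ⟩
    ∑[ t ∈ L ] ∑[ i ∈ U ] ∑[ ts ∈ Ts ] G t ts i
      ≈⟨ ∑-comm L U _ ⟩
    ∑[ i ∈ U ] ∑[ t ∈ L ] ∑[ ts ∈ Ts ] G t ts i
      ≈⟨ ∑-cong U (λ i → ∑-cong L λ t → ∑-distribˡ Ts _ _) ⟨
    ∑[ i ∈ U ] ∑[ t ∈ L ] ([ size t ≟ i ]· hp t * (∑[ ts ∈ Ts ] [ sizes ts ≟ m ∸ i ]· hps ts))
      ≈⟨ ∑-cong U (λ i → ∑-distribʳ L _ _) ⟨
    ∑[ i ∈ U ] (hookSeries L i * (∑[ ts ∈ Ts ] [ sizes ts ≟ m ∸ i ]· hps ts))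
      ≈⟨ ∑-cong U (λ i → *-congˡ (∑-tuples j L (m ∸ i))) ⟩
    _^_ K (hookSeries L) (suc j) m
      ∎
    where
    hp : Tree k → Carrier
    hp = hookProd K ρ

    hps : ∀ {n} → Vec (Tree k) n → Carrier
    hps = hookProds K ρ

    Ts : List (Vec (Tree k) j)
    Ts = tuples j L

    U : List ℕ
    U = upTo (suc m)

    F : Vec (Tree k) (suc j) → Carrier
    F ts = [ sizes ts ≟ m ]· hps ts

    G : Tree k → Vec (Tree k) j → ℕ → Carrier
    G t ts i = [ size t ≟ i ]· hp t * [ sizes ts ≟ m ∸ i ]· hps ts

  hookSeries-0 : ∀ h → hookSeries (treesOfHeight≤ k h) 0 ≈ 1#
  hookSeries-0 zero    = +-identityʳ 1#
  hookSeries-0 (suc h) = begin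
    1# + ∑ (map node Ts) (λ t → [ size t ≟ 0 ]· hookProd K ρ t)  ≈⟨ +-congˡ (∑-map Ts node _) ⟩
    1# + ∑[ _ ∈ Ts ] 0#                                          ≈⟨ +-congˡ (∑-zero Ts) ⟩
    1# + 0#                                                      ≈⟨ +-identityʳ 1# ⟩
    1#                                                           ∎
    where
    Ts : List (Vec (Tree k) k)
    Ts = tuples k (treesOfHeight≤ k h)

  hookSeries-suc : ∀ h m →
    hookSeries (treesOfHeight≤ k (suc h)) (suc m)
      ≈ ρ (suc m) * _^_ K (hookSeries (treesOfHeight≤ k h)) k m
  hookSeries-suc h m = begin
    0# + ∑ (map node Ts) (λ t → [ size t ≟ suc m ]· hookProd K ρ t)
      ≈⟨ +-identityˡ _ ⟩
    ∑ (map node Ts) (λ t → [ size t ≟ suc m ]· hookProd K ρ t)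
      ≈⟨ ∑-map Ts node _ ⟩
    ∑[ ts ∈ Ts ] [ suc (sizes ts) ≟ suc m ]· (ρ (suc (sizes ts)) * hookProds K ρ ts)
      ≈⟨ ∑-cong Ts (λ ts → root-hook (sizes ts) (hookProds K ρ ts)) ⟩
    ∑[ ts ∈ Ts ] (ρ (suc m) * [ sizes ts ≟ m ]· hookProds K ρ ts)
      ≈⟨ ∑-distribˡ Ts _ _ ⟨
    ρ (suc m) * (∑[ ts ∈ Ts ] [ sizes ts ≟ m ]· hookProds K ρ ts)
      ≈⟨ *-congˡ (∑-tuples k (treesOfHeight≤ k h) m) ⟩
    ρ (suc m) * _^_ K (hookSeries (treesOfHeight≤ k h)) k m
      ∎
    where
    Ts : List (Vec (Tree k) k)
    Ts = tuples k (treesOfHeight≤ k h)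

    root-hook : ∀ s H → [ suc s ≟ suc m ]· (ρ (suc s) * H) ≈ ρ (suc m) * [ s ≟ m ]· H
    root-hook s H = begin
      [ suc s ≟ suc m ]· (ρ (suc s) * H)  ≈⟨ []·-subst (λ x → ρ x * H) (suc s ≟ suc m) ⟨
      [ suc s ≟ suc m ]· (ρ (suc m) * H)  ≈⟨ []·-⇔ suc⇔ (suc s ≟ suc m) (s ≟ m) _ ⟩
      [ s ≟ m ]· (ρ (suc m) * H)          ≈⟨ []·-*ˡ (s ≟ m) _ H ⟨
      ρ (suc m) * [ s ≟ m ]· H            ∎

  hookSeries-stable-suc : ∀ h {i} → i ≤ h →
    hookSeries (treesOfHeight≤ k h) i ≈ hookSeries (treesOfHeight≤ k (suc h)) i
  hookSeries-stable-suc h       {zero}  _         =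
    trans (hookSeries-0 h) (sym (hookSeries-0 (suc h)))
  hookSeries-stable-suc (suc h) {suc m} (s≤s m≤h) = begin
    hookSeries (treesOfHeight≤ k (suc h)) (suc m)              ≈⟨ hookSeries-suc h m ⟩
    ρ (suc m) * _^_ K (hookSeries (treesOfHeight≤ k h)) k m
      ≈⟨ *-congˡ (^-cong≤ k m λ i≤m → hookSeries-stable-suc h (ℕ.≤-trans i≤m m≤h)) ⟩
    ρ (suc m) * _^_ K (hookSeries (treesOfHeight≤ k (suc h))) k m ≈⟨ hookSeries-suc (suc h) m ⟨
    hookSeries (treesOfHeight≤ k (suc (suc h))) (suc m)        ∎

  hookSeries-stable : ∀ {i h} → i ≤ h →
    hookSeries (treesOfHeight≤ k i) i ≈ hookSeries (treesOfHeight≤ k h) i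
  hookSeries-stable {h = zero}  z≤n = refl
  hookSeries-stable {h = suc h} i≤1+h with ℕ.m≤n⇒m<n∨m≡n i≤1+h
  ... | inj₁ (s≤s i≤h) = trans (hookSeries-stable i≤h) (hookSeries-stable-suc h i≤h)
  ... | inj₂ ≡.refl    = refl

  treeSeries : PowerSeries K
  treeSeries n = hookSeries (treesOfHeight≤ k n) n

  ∑-T≈treeSeries : ∀ n → Σ-list K (map (hookProd K ρ) (T k n)) ≈ treeSeries n
  ∑-T≈treeSeries n = ∑-filter (treesOfHeight≤ k n) (λ t → size t ≟ n) (hookProd K ρ)

  treeSeries-suc : ∀ m → treeSeries (suc m) ≈ ρ (suc m) * _^_ K treeSeries k m
  treeSeries-suc m = trans (hookSeries-suc m m)
    (*-congˡ (^-cong≤ k m λ i≤m → sym (hookSeries-stable i≤m)))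

theorem2p1 : ∀ {c ℓ} (K : Field c ℓ) (k : ℕ) → 1 ≤ k →
    (ρ : ℕ → Field.Carrier K) (f : PowerSeries K) →
    Field._≈_ K (coeff K 0 f) (Field.1# K) →
    (∀ n → 1 ≤ n →
      Field._≈_ K (coeff K n f) (Σ-list K (map (hookProd K ρ) (T k n)))) →
    ∀ n → 1 ≤ n →
    (nz : ¬ Field._≈_ K (coeff K (n ∸ 1) (_^_ K f k)) (Field.0# K)) →
    Field._≈_ K (ρ n)
      (Field._*_ K (coeff K n f) (Field._⁻¹ K (coeff K (n ∸ 1) (_^_ K f k)) nz))
theorem2p1 K k _ ρ f f₀≈1 fₙ≈∑T (suc m) _ nz =
  x≈y*c⇒y≈x*c⁻¹ nz (trans (f≈treeSeries (suc m)) (trans (treeSeries-suc m) f^k-coeff))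
  where
  open Field K
  open FieldSums K
  open HookSeries K k ρ

  f≈treeSeries : ∀ n → f n ≈ treeSeries n
  f≈treeSeries zero    = trans f₀≈1 (sym (hookSeries-0 0))
  f≈treeSeries (suc n) = trans (fₙ≈∑T (suc n) (s≤s z≤n)) (∑-T≈treeSeries (suc n))

  f^k-coeff : ρ (suc m) * _^_ K treeSeries k m ≈ ρ (suc m) * _^_ K f k m
  f^k-coeff = *-congˡ (^-cong≤ k m λ {i} _ → sym (f≈treeSeries i))
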